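{- Let $G$ be a finite, simple, undirected, connected graph with at least two vertices. Then $$\gamma(G)\ge \frac{1}{2}\bigl(ecc_G(B)+1\bigr),$$ where $B$ is the boundary of $G$.
   Context: The domination number $\gamma(G)$ is the minimum cardinality of a set $S\subseteq V(G)$ such that every vertex of $G$ belongs to $S$ or is adjacent to a vertex of $S$. $d_G(x,y)$ is the shortest-path distance in $G$. The eccentricity of a vertex $v$ is $ecc_G(v)=\max\{d_G(v,x) : x\in V(G)\}$, and $diam(G)=\max\{d_G(x,y): x,y\in V(G)\}$. The boundary of $G$ is $B=\{v\in V(G) : ecc_G(v)=diam(G)\}$. For $v\in V(G)$ and $S\subseteq V(G)$, $d_G(v,S)=\min\{d_G(v,x) : x\in S\}$, and the eccentricity of $S$ is $ecc_G(S)=\max\{d_G(x,S) : x\in V(G)\}$. -}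

module Defs where

open import Data.Nat using (ℕ; zero; suc; _≤_)
open import Data.Fin using (Fin)
open import Data.Fin.Subset using (Subset; _∈_; ∣_∣)
open import Data.Product using (Σ; ∃; ∃-syntax; _×_; _,_)
open import Data.Sum using (_⊎_)
open import Relation.Nullary using (¬_; Dec)
open import Relation.Binary.PropositionalEquality using (_≡_)

record Graph (n : ℕ) : Set₁ where
  field
    Adj    : Fin n → Fin n → Set
    adj?   : ∀ x y → Dec (Adj x y)
    sym    : ∀ {x y} → Adj x y → Adj y x
    irrefl : ∀ {x} → ¬ Adj x x

module _ {n : ℕ} (G : Graph n) where
  open Graph G

  data Walk : Fin n → Fin n → ℕ → Set where
    here : ∀ {x} → Walk x x zero
    step : ∀ {x y z k} → Adj x y → Walk y z k → Walk x z (suc k)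

  Connected : Set
  Connected = ∀ x y → ∃[ k ] Walk x y k

  Dist : Fin n → Fin n → ℕ → Set
  Dist x y k = Walk x y k × (∀ m → Walk x y m → k ≤ m)

  Ecc : Fin n → ℕ → Set
  Ecc v e = (∀ x → ∃[ k ] (Dist v x k × k ≤ e)) × (∃[ x ] Dist v x e)

  Diam : ℕ → Set
  Diam D = (∃[ x ] ∃[ y ] Dist x y D) × (∀ x y k → Dist x y k → k ≤ D)

  Boundary : Fin n → Set
  Boundary v = ∃[ D ] (Diam D × Ecc v D)

  DistSet : Fin n → (Fin n → Set) → ℕ → Set
  DistSet v S k = (∃[ s ] (S s × Walk v s k))
                × (∀ s → S s → ∀ m → Walk v s m → k ≤ m)

  EccSet : (Fin n → Set) → ℕ → Set
  EccSet S e = (∀ x → ∃[ k ] (DistSet x S k × k ≤ e)) × (∃[ x ] DistSet x S e)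

  Dominating : Subset n → Set
  Dominating S = ∀ v → v ∈ S ⊎ (∃[ u ] (u ∈ S × Adj v u))

  DomNumber : ℕ → Set
  DomNumber g = (∃[ S ] (Dominating S × ∣ S ∣ ≡ g))
              × (∀ S → Dominating S → g ≤ ∣ S ∣)

-- Let x realise e = ecc(B) and let u, v be a diametral pair; then u, v ∈ B, so d(x,u), d(x,v) ≥ e,
-- and d(u,v) = diam > e (if d(x,u) = diam then x ∈ B and e = 0). Take a minimum dominating set S.
-- Every vertex at level p (distance p from x) on a shortest x–u or x–v path has a dominator in S,
-- whose own level is p − 1, p or p + 1; so a vertex of S serves at most three levels on each path.
-- Above level T ≈ (d(x,u) + d(x,v) − d(u,v) + 3)/2 a single vertex cannot serve both paths (its
-- distances to u and v would violate the triangle inequality for d(u,v)), so counting the levels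
-- served gives d(x,u) + d(x,v) + d(u,v) ≤ 6|S|, i.e. 3e + 1 ≤ 6γ(G).
module Submission where

open import Defs
open import Data.Nat using (ℕ; zero; suc; _+_; _*_; _∸_; _≤_; _<_; z≤n; s≤s; _≤?_)
open import Data.Nat.Properties
open import Data.Nat.Tactic.RingSolver using (solve)
open import Data.Bool using (if_then_else_)
open import Data.Empty using (⊥-elim)
open import Data.Fin using (Fin; zero; suc; toℕ)
import Data.Fin as Fin
open import Data.Fin.Properties using (any?)
open import Data.Fin.Subset using (Subset; _∈_; ∣_∣; inside; outside)
open import Data.Fin.Subset.Properties using (_∈?_)
open import Data.List using (_∷_; [])
import Data.Vec as Vec
open import Data.Product using (∃-syntax; _×_; _,_; proj₁; proj₂)
open import Data.Sum using (inj₁; inj₂)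
open import Function using (_∘_)
open import Relation.Nullary using (¬_; Dec; yes; no; does)
open import Relation.Nullary.Decidable using (_×-dec_)
open import Relation.Unary using (Decidable)
open import Relation.Binary.PropositionalEquality
  using (_≡_; _≢_; refl; sym; trans; cong; subst; subst₂; module ≡-Reasoning)
open import Algebra.Properties.Semiring.Sum +-*-semiring
  using (sum; sum-syntax; sum-cong-≗; ∑-comm; ∑-distrib-+; *-distribˡ-sum)
open import Algebra.Properties.CommutativeSemigroup +-commutativeSemigroup using (interchange)

halve : ∀ N → ∃[ T ] (N ≤ T + T × T + T ≤ suc N)
halve zero          = 0 , z≤n , z≤n
halve (suc zero)    = 1 , s≤s z≤n , ≤-refl
halve (suc (suc N)) with halve N
... | T , N≤2T , 2T≤1+N = suc T , subst (suc (suc N) ≤_) (sym (+-suc (suc T) T)) (s≤s (s≤s N≤2T))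
                                , subst (_≤ suc (suc (suc N))) (sym (+-suc (suc T) T)) (s≤s (s≤s 2T≤1+N))

halve-difference : ∀ {m N} → m ≤ N → ∃[ T ] (N ≤ m + (T + T) × m + (T + T) ≤ suc N)
halve-difference {m} {N} m≤N =
  let T , lower , upper = halve (N ∸ m)
  in T , subst (_≤ m + (T + T)) (m+[n∸m]≡n m≤N) (+-monoʳ-≤ m lower)
       , subst (m + (T + T) ≤_) (trans (+-suc m (N ∸ m)) (cong suc (m+[n∸m]≡n m≤N))) (+-monoʳ-≤ m upper)

perimeter-arithmetic : ∀ a b D T r k → D + (T + T) ≤ 4 + (a + b) → suc b ≤ T + r → suc a + r ≤ k →
                       a + b + D ≤ 2 * k
perimeter-arithmetic a b D T r k D+2T≤ b<T+r 1+a+r≤k = +-cancelʳ-≤ (T + T) (a + b + D) (2 * k) (begin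
  a + b + D + (T + T)       ≡⟨ +-assoc (a + b) D (T + T) ⟩
  a + b + (D + (T + T))     ≤⟨ +-monoʳ-≤ (a + b) D+2T≤ ⟩
  a + b + (4 + (a + b))     ≡⟨ solve (a ∷ b ∷ []) ⟩
  2 * (suc a + suc b)       ≤⟨ *-monoʳ-≤ 2 (+-monoʳ-≤ (suc a) b<T+r) ⟩
  2 * (suc a + (T + r))     ≡⟨ solve (a ∷ T ∷ r ∷ []) ⟩
  2 * (suc a + r) + (T + T) ≤⟨ +-monoˡ-≤ (T + T) (*-monoʳ-≤ 2 1+a+r≤k) ⟩
  2 * k + (T + T)           ∎)
  where open ≤-Reasoning

3e+1≤6g⇒e+1≤2g : ∀ e g → 3 * e + 1 ≤ 6 * g → e + 1 ≤ 2 * g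
3e+1≤6g⇒e+1≤2g e g 3e+1≤6g = subst (_≤ 2 * g) (+-comm 1 e) (*-cancelˡ-< 3 e (2 * g) (begin-strict
  3 * e       <⟨ ≤-reflexive (+-comm 1 (3 * e)) ⟩
  3 * e + 1   ≤⟨ 3e+1≤6g ⟩
  6 * g       ≡⟨ *-assoc 3 2 g ⟩
  3 * (2 * g) ∎))
  where open ≤-Reasoning

indicator : ∀ {P : Set} → Dec P → ℕ
indicator P? = if does P? then 1 else 0

indicator≤1 : ∀ {P : Set} (P? : Dec P) → indicator P? ≤ 1
indicator≤1 (yes _) = ≤-refl
indicator≤1 (no _)  = z≤n

indicator-yes : ∀ {P : Set} (P? : Dec P) → P → 1 ≤ indicator P?
indicator-yes (yes _) _ = ≤-refl
indicator-yes (no ¬p) p = ⊥-elim (¬p p)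

indicator-mono : ∀ {P Q : Set} (P? : Dec P) (Q? : Dec Q) → (P → Q) → indicator P? ≤ indicator Q?
indicator-mono (yes p) Q? P⇒Q = indicator-yes Q? (P⇒Q p)
indicator-mono (no _)  _  _   = z≤n

indicator-exclusive : ∀ {P Q R : Set} (P? : Dec P) (Q? : Dec Q) (R? : Dec R) →
                      (P → R) → (Q → R) → (P → ¬ Q) → indicator P? + indicator Q? ≤ indicator R?
indicator-exclusive (yes p) (yes q) _  _   _   P⇒¬Q = ⊥-elim (P⇒¬Q p q)
indicator-exclusive (yes p) (no _)  R? P⇒R _   _    = indicator-yes R? (P⇒R p)
indicator-exclusive (no _)  (yes q) R? _   Q⇒R _    = indicator-yes R? (Q⇒R q)
indicator-exclusive (no _)  (no _)  _  _   _   _    = z≤n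

sum-mono-≤ : ∀ {n} {f g : Fin n → ℕ} → (∀ i → f i ≤ g i) → sum f ≤ sum g
sum-mono-≤ {zero}  f≤g = z≤n
sum-mono-≤ {suc n} f≤g = +-mono-≤ (f≤g zero) (sum-mono-≤ (f≤g ∘ suc))

term≤sum : ∀ {n} (f : Fin n → ℕ) i → f i ≤ sum f
term≤sum f zero    = m≤m+n (f zero) _
term≤sum f (suc i) = ≤-trans (term≤sum (f ∘ suc) i) (m≤n+m _ (f zero))

indicator≤sum : ∀ {n} {P : Set} (P? : Dec P) (f : Fin n → ℕ) → (P → ∃[ i ] (1 ≤ f i)) →
                indicator P? ≤ sum f
indicator≤sum (yes p) f witness = let i , 1≤fi = witness p in ≤-trans 1≤fi (term≤sum f i)
indicator≤sum (no _)  f _       = z≤n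

sum-membership : ∀ {n} (S : Subset n) → ∑[ s < n ] indicator (s ∈? S) ≡ ∣ S ∣
sum-membership Vec.[]            = refl
sum-membership (inside  Vec.∷ S) = cong suc (sum-membership S)
sum-membership (outside Vec.∷ S) = sum-membership S

count : ∀ L {P : ℕ → Set} → Decidable P → ℕ
count L P? = ∑[ i < L ] indicator (P? (toℕ i))

count-mono : ∀ L {P Q : ℕ → Set} (P? : Decidable P) (Q? : Decidable Q) →
             (∀ {p} → P p → Q p) → count L P? ≤ count L Q?
count-mono L P? Q? P⇒Q = sum-mono-≤ {L} λ i → indicator-mono (P? (toℕ i)) (Q? (toℕ i)) P⇒Q

count-empty : ∀ L {P : ℕ → Set} (P? : Decidable P) → (∀ p → ¬ P p) → count L P? ≡ 0
count-empty zero    P? ¬P = refl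
count-empty (suc L) P? ¬P with P? 0
... | yes P0 = ⊥-elim (¬P 0 P0)
... | no _   = count-empty L (P? ∘ suc) (¬P ∘ suc)

InRange : ℕ → ℕ → ℕ → Set
InRange lo hi p = lo ≤ p × p ≤ hi

inRange? : ∀ lo hi → Decidable (InRange lo hi)
inRange? lo hi p = lo ≤? p ×-dec p ≤? hi

count-inRange-≤ : ∀ L lo hi → count L (inRange? lo hi) ≤ suc hi ∸ lo
count-inRange-≤ zero    lo       hi       = z≤n
count-inRange-≤ (suc L) zero     zero     =
  +-mono-≤ (indicator≤1 (inRange? 0 0 0))
           (≤-reflexive (count-empty L (inRange? 0 0 ∘ suc) λ { _ (_ , ()) }))
count-inRange-≤ (suc L) zero     (suc hi) =
  +-mono-≤ (indicator≤1 (inRange? 0 (suc hi) 0))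
           (≤-trans (count-mono L (inRange? 0 (suc hi) ∘ suc) (inRange? 0 hi)
                                λ { (_ , s≤s p≤hi) → z≤n , p≤hi })
                    (count-inRange-≤ L 0 hi))
count-inRange-≤ (suc L) (suc lo) zero     =
  ≤-trans (≤-reflexive (count-empty (suc L) (inRange? (suc lo) 0) λ { zero (() , _) ; (suc _) (_ , ()) }))
          z≤n
-- The term for level 0 vanishes by computation: suc lo ≤? 0 reduces to no.
count-inRange-≤ (suc L) (suc lo) (suc hi) =
  ≤-trans (count-mono L (inRange? (suc lo) (suc hi) ∘ suc) (inRange? lo hi)
                      λ { (s≤s lo≤p , s≤s p≤hi) → lo≤p , p≤hi })
          (count-inRange-≤ L lo hi)

count-inRange-≥ : ∀ L lo hi → hi < L → suc hi ∸ lo ≤ count L (inRange? lo hi)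
count-inRange-≥ (suc L) zero     zero     _          = m≤m+n 1 _
count-inRange-≥ (suc L) zero     (suc hi) (s≤s hi<L) =
  s≤s (≤-trans (count-inRange-≥ L 0 hi hi<L)
               (count-mono L (inRange? 0 hi) (inRange? 0 (suc hi) ∘ suc)
                           λ { (_ , p≤hi) → z≤n , s≤s p≤hi }))
count-inRange-≥ (suc L) (suc lo) zero     _          = ≤-trans (≤-reflexive (0∸n≡0 lo)) z≤n
count-inRange-≥ (suc L) (suc lo) (suc hi) (s≤s hi<L) =
  ≤-trans (count-inRange-≥ L lo hi hi<L)
          (count-mono L (inRange? lo hi) (inRange? (suc lo) (suc hi) ∘ suc)
                      λ { (lo≤p , p≤hi) → s≤s lo≤p , s≤s p≤hi })

WithinOne : ℕ → ℕ → Set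
WithinOne c p = c ≤ suc p × p ≤ suc c

withinOne? : ∀ c → Decidable (WithinOne c)
withinOne? c p = c ≤? suc p ×-dec p ≤? suc c

count-withinOne : ∀ L c → count L (withinOne? c) ≤ 3
count-withinOne L c = begin
  count L (withinOne? c)             ≤⟨ count-mono L (withinOne? c) (inRange? (c ∸ 1) (suc c))
                                          (λ { (c≤1+p , p≤1+c) → ∸-monoˡ-≤ 1 c≤1+p , p≤1+c }) ⟩
  count L (inRange? (c ∸ 1) (suc c)) ≤⟨ count-inRange-≤ L (c ∸ 1) (suc c) ⟩
  suc (suc c) ∸ (c ∸ 1)              ≤⟨ width c ⟩
  3                                  ∎
  where
  open ≤-Reasoning
  width : ∀ c → suc (suc c) ∸ (c ∸ 1) ≤ 3
  width zero    = s≤s (s≤s z≤n)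
  width (suc c) = ≤-reflexive (m+n∸n≡m 3 c)

-- C₁ s p / C₂ s p: the vertex s serves level p on the first / second branch.
module TwoBranchCovering
  {n} (S : Subset n) (level : Fin n → ℕ)
  {C₁ C₂ : Fin n → ℕ → Set} (C₁? : ∀ s → Decidable (C₁ s)) (C₂? : ∀ s → Decidable (C₂ s))
  (near₁ : ∀ {s p} → C₁ s p → WithinOne (level s) p)
  (near₂ : ∀ {s p} → C₂ s p → WithinOne (level s) p)
  (exclusive : ∀ {s p} → C₁ s p → ¬ C₂ s p)
  where

  private
    member : Fin n → ℕ
    member s = indicator (s ∈? S)

    load : ∀ {C : Fin n → ℕ → Set} → (∀ s → Decidable (C s)) → ℕ → ℕ
    load C? p = ∑[ s < n ] (member s * indicator (C? s p))

    served : Fin n → ℕ → ℕ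
    served s p = member s * (indicator (C₁? s p) + indicator (C₂? s p))

    demand≤load : ∀ {C : Fin n → ℕ → Set} (C? : ∀ s → Decidable (C s)) lo hi →
                  (∀ {p} → InRange lo hi p → ∃[ s ] (s ∈ S × C s p)) →
                  ∀ p → indicator (inRange? lo hi p) ≤ load C? p
    demand≤load C? lo hi covered p = indicator≤sum (inRange? lo hi p) _ λ p∈ →
      let s , s∈S , Csp = covered p∈
      in s , *-mono-≤ (indicator-yes (s ∈? S) s∈S) (indicator-yes (C? s p) Csp)

    load-+ : ∀ p → load C₁? p + load C₂? p ≡ ∑[ s < n ] served s p
    load-+ p = begin
      load C₁? p + load C₂? p
        ≡⟨ ∑-distrib-+ {n} (λ s → member s * indicator (C₁? s p)) _ ⟨
      ∑[ s < n ] (member s * indicator (C₁? s p) + member s * indicator (C₂? s p))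
        ≡⟨ sum-cong-≗ {n} (λ s → *-distribˡ-+ (member s) _ _) ⟨
      ∑[ s < n ] served s p ∎
      where open ≡-Reasoning

    served-by-vertex : ∀ L s → ∑[ p < L ] served s (toℕ p) ≤ 3 * member s
    served-by-vertex L s = begin
      ∑[ p < L ] served s (toℕ p)
        ≡⟨ *-distribˡ-sum {L} (member s) (λ p → indicator (C₁? s (toℕ p)) + indicator (C₂? s (toℕ p))) ⟨
      member s * ∑[ p < L ] (indicator (C₁? s (toℕ p)) + indicator (C₂? s (toℕ p)))
        ≤⟨ *-monoʳ-≤ (member s) (sum-mono-≤ {L} λ p →
             indicator-exclusive (C₁? s (toℕ p)) (C₂? s (toℕ p)) (withinOne? (level s) (toℕ p))
                                 near₁ near₂ exclusive) ⟩
      member s * count L (withinOne? (level s))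
        ≤⟨ *-monoʳ-≤ (member s) (count-withinOne L (level s)) ⟩
      member s * 3
        ≡⟨ *-comm (member s) 3 ⟩
      3 * member s ∎
      where open ≤-Reasoning

  two-branch-covering : ∀ lo₁ hi₁ lo₂ hi₂ →
    (∀ {p} → InRange lo₁ hi₁ p → ∃[ s ] (s ∈ S × C₁ s p)) →
    (∀ {p} → InRange lo₂ hi₂ p → ∃[ s ] (s ∈ S × C₂ s p)) →
    (suc hi₁ ∸ lo₁) + (suc hi₂ ∸ lo₂) ≤ 3 * ∣ S ∣
  two-branch-covering lo₁ hi₁ lo₂ hi₂ covered₁ covered₂ = begin
    (suc hi₁ ∸ lo₁) + (suc hi₂ ∸ lo₂)
      ≤⟨ +-mono-≤ (count-inRange-≥ L lo₁ hi₁ (s≤s (m≤m+n hi₁ hi₂)))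
                  (count-inRange-≥ L lo₂ hi₂ (s≤s (m≤n+m hi₂ hi₁))) ⟩
    count L (inRange? lo₁ hi₁) + count L (inRange? lo₂ hi₂)
      ≤⟨ +-mono-≤ (sum-mono-≤ {L} (demand≤load C₁? lo₁ hi₁ covered₁ ∘ toℕ))
                  (sum-mono-≤ {L} (demand≤load C₂? lo₂ hi₂ covered₂ ∘ toℕ)) ⟩
    ∑[ p < L ] load C₁? (toℕ p) + ∑[ p < L ] load C₂? (toℕ p)
      ≡⟨ ∑-distrib-+ {L} (load C₁? ∘ toℕ) (load C₂? ∘ toℕ) ⟨
    ∑[ p < L ] (load C₁? (toℕ p) + load C₂? (toℕ p))
      ≡⟨ sum-cong-≗ {L} (load-+ ∘ toℕ) ⟩
    ∑[ p < L ] ∑[ s < n ] served s (toℕ p)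
      ≡⟨ ∑-comm {L} {n} (λ p s → served s (toℕ p)) ⟩
    ∑[ s < n ] ∑[ p < L ] served s (toℕ p)
      ≤⟨ sum-mono-≤ {n} (served-by-vertex L) ⟩
    ∑[ s < n ] (3 * member s)
      ≡⟨ *-distribˡ-sum {n} 3 member ⟨
    3 * ∑[ s < n ] member s
      ≡⟨ cong (3 *_) (sum-membership S) ⟩
    3 * ∣ S ∣ ∎
    where
    open ≤-Reasoning
    L = suc (hi₁ + hi₂)

minimal-witness : ∀ {P : ℕ → Set} → Decidable P → ∀ {k} → P k → ∃[ m ] (P m × (∀ {j} → P j → m ≤ j))
minimal-witness P? {k} Pk with P? 0
... | yes P0 = 0 , P0 , λ _ → z≤n
minimal-witness P? {zero}  Pk | no ¬P0 = ⊥-elim (¬P0 Pk)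
minimal-witness P? {suc k} Pk | no ¬P0 with minimal-witness (P? ∘ suc) Pk
... | m , Psm , least = suc m , Psm , λ { {zero} P0 → ⊥-elim (¬P0 P0) ; {suc j} Psj → s≤s (least Psj) }

module Walks {n} (G : Graph n) where
  open Graph G using (adj?) renaming (sym to adj-sym)

  infixr 5 _++ʷ_
  _++ʷ_ : ∀ {x y z k l} → Walk G x y k → Walk G y z l → Walk G x z (k + l)
  here      ++ʷ q = q
  step xy p ++ʷ q = step xy (p ++ʷ q)

  reverse : ∀ {x y k} → Walk G x y k → Walk G y x k
  reverse here = here
  reverse {k = suc k} (step xy p) = subst (Walk G _ _) (+-comm k 1) (reverse p ++ʷ step (adj-sym xy) here)

  splitAt : ∀ k {l x y} → Walk G x y (k + l) → ∃[ z ] (Walk G x z k × Walk G z y l)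
  splitAt zero    w           = _ , here , w
  splitAt (suc k) (step xy w) = let z , w₁ , w₂ = splitAt k w in z , step xy w₁ , w₂

  walk? : ∀ k x y → Dec (Walk G x y k)
  walk? zero x y with x Fin.≟ y
  ... | yes refl = yes here
  ... | no x≢y   = no λ { here → x≢y refl }
  walk? (suc k) x y with any? (λ z → adj? x z ×-dec walk? k z y)
  ... | yes (z , xz , w) = yes (step xz w)
  ... | no ∄z            = no λ { (step xz w) → ∄z (_ , xz , w) }

  walk₀⇒≡ : ∀ {x y} → Walk G x y 0 → x ≡ y
  walk₀⇒≡ here = refl

  Dist-sym : ∀ {x y k} → Dist G x y k → Dist G y x k
  Dist-sym (w , minimal) = reverse w , λ m w′ → minimal m (reverse w′)

module Distance {n} (G : Graph n) (connected : Connected G) where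
  open Walks G

  private
    shortest : ∀ x y → ∃[ m ] (Walk G x y m × (∀ {j} → Walk G x y j → m ≤ j))
    shortest x y = minimal-witness (λ k → walk? k x y) (proj₂ (connected x y))

  d : Fin n → Fin n → ℕ
  d x y = proj₁ (shortest x y)

  d-walk : ∀ x y → Walk G x y (d x y)
  d-walk x y = proj₁ (proj₂ (shortest x y))

  d-minimal : ∀ {x y k} → Walk G x y k → d x y ≤ k
  d-minimal {x} {y} = proj₂ (proj₂ (shortest x y))

  Dist-d : ∀ x y → Dist G x y (d x y)
  Dist-d x y = d-walk x y , λ _ → d-minimal

  Dist⇒≡d : ∀ {x y k} → Dist G x y k → k ≡ d x y
  Dist⇒≡d {x} {y} (w , minimal) = ≤-antisym (minimal _ (d-walk x y)) (d-minimal w)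

  d-triangle : ∀ x y z → d x z ≤ d x y + d y z
  d-triangle x y z = d-minimal (d-walk x y ++ʷ d-walk y z)

  d-sym : ∀ x y → d x y ≡ d y x
  d-sym x y = ≤-antisym (d-minimal (reverse (d-walk y x))) (d-minimal (reverse (d-walk x y)))

  d-triangle-through : ∀ x u v → d u v ≤ d x u + d x v
  d-triangle-through x u v = subst (λ i → d u v ≤ i + d x v) (d-sym u x) (d-triangle u x v)

  d-close : ∀ {z s} → d z s ≤ 1 → ∀ y → WithinOne (d y s) (d y z)
  d-close {z} {s} zs≤1 y =
    ≤-trans (d-triangle y z s) (≤-trans (+-monoʳ-≤ (d y z) zs≤1) (≤-reflexive (+-comm (d y z) 1))) ,
    ≤-trans (d-triangle y s z) (≤-trans (+-monoʳ-≤ (d y s) sz≤1) (≤-reflexive (+-comm (d y s) 1)))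
    where
    sz≤1 : d s z ≤ 1
    sz≤1 = subst (_≤ 1) (d-sym z s) zs≤1

  dominator : ∀ {S : Subset n} → Dominating G S → ∀ z → ∃[ s ] (s ∈ S × d z s ≤ 1)
  dominator dominating z with dominating z
  ... | inj₁ z∈S            = z , z∈S , ≤-trans (d-minimal {z} here) z≤n
  ... | inj₂ (s , s∈S , zs) = s , s∈S , d-minimal (step zs here)

  geodesic-point : ∀ x y {p} → p ≤ d x y → ∃[ z ] (d x z ≡ p × d z y + p ≤ d x y)
  geodesic-point x y {p} p≤xy
    with splitAt p (subst (Walk G x y) (sym (m+[n∸m]≡n p≤xy)) (d-walk x y))
  ... | z , xz , zy = z , ≤-antisym (d-minimal xz) p≤xz , zy+p≤xy
    where
    zy+p≤xy : d z y + p ≤ d x y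
    zy+p≤xy = ≤-trans (+-monoˡ-≤ p (d-minimal zy)) (≤-reflexive (m∸n+n≡m p≤xy))
    p≤xz : p ≤ d x z
    p≤xz = +-cancelʳ-≤ (d z y) p (d x z) (begin
      p + d z y     ≡⟨ +-comm p (d z y) ⟩
      d z y + p     ≤⟨ zy+p≤xy ⟩
      d x y         ≤⟨ d-triangle x z y ⟩
      d x z + d z y ∎)
      where open ≤-Reasoning

  Diam-positive : ∀ {x y D} → x ≢ y → Diam G D → 1 ≤ D
  Diam-positive {D = suc D} _ _ = s≤s z≤n
  Diam-positive {x} {y} {D = zero} x≢y (_ , bounded) =
    ⊥-elim (x≢y (walk₀⇒≡ (subst (Walk G x y) (n≤0⇒n≡0 (bounded x y _ (Dist-d x y))) (d-walk x y))))

  diametral-in-boundary : ∀ {x y D} → Diam G D → Dist G x y D → Boundary G x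
  diametral-in-boundary {x} {D = D} diam xy =
    D , diam , (λ z → d x z , Dist-d x z , proj₂ diam x z _ (Dist-d x z)) , (_ , xy)

  boundary-lower-bound<Diam : ∀ {i j z D e} → i ≢ j → Diam G D →
                              (∀ s → Boundary G s → ∀ m → Walk G z s m → e ≤ m) → e < D
  boundary-lower-bound<Diam {z = z} i≢j diam below with proj₁ diam
  ... | u , _ , uv with m≤n⇒m<n∨m≡n (proj₂ diam z u _ (Dist-d z u))
  ... | inj₁ zu<D = ≤-<-trans (below u (diametral-in-boundary diam uv) _ (d-walk z u)) zu<D
  ... | inj₂ zu≡D = ≤-trans (s≤s (below z z∈B 0 here)) (Diam-positive i≢j diam)
    where
    z∈B : Boundary G z
    z∈B = diametral-in-boundary diam (subst (Dist G z u) zu≡D (Dist-d z u))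

module Perimeter {n} (G : Graph n) (connected : Connected G)
                 {S : Subset n} (dominating : Dominating G S) (x : Fin n) where
  open Distance G connected

  -- What a dominator of the level-p vertex of a shortest path from x to w satisfies.
  Covers : Fin n → Fin n → ℕ → Set
  Covers w s p = WithinOne (d x s) p × d s w + p ≤ suc (d x w)

  covers? : ∀ w s → Decidable (Covers w s)
  covers? w s p = withinOne? (d x s) p ×-dec d s w + p ≤? suc (d x w)

  geodesic-covered : ∀ w {p} → p ≤ d x w → ∃[ s ] (s ∈ S × Covers w s p)
  geodesic-covered w {p} p≤xw with geodesic-point x w p≤xw
  ... | z , refl , zw+p≤xw with dominator dominating z
  ... | s , s∈S , zs≤1 = s , s∈S , d-close zs≤1 x , (begin
    d s w + p       ≤⟨ +-monoˡ-≤ p sw≤1+zw ⟩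
    suc (d z w + p) ≤⟨ s≤s zw+p≤xw ⟩
    suc (d x w)     ∎)
    where
    open ≤-Reasoning
    sw≤1+zw : d s w ≤ suc (d z w)
    sw≤1+zw = subst₂ (λ i j → i ≤ suc j) (d-sym w s) (d-sym w z) (proj₁ (d-close zs≤1 w))

  covers-exclusive : ∀ {u v T s p} → 3 + (d x u + d x v) ≤ d u v + (T + T) →
                     Covers u s p → ¬ (T ≤ p × Covers v s p)
  covers-exclusive {u} {v} {T} {s} {p} threshold (_ , su+p≤) (T≤p , _ , sv+p≤) = <-irrefl refl (begin
    3 + (d x u + d x v)       ≤⟨ threshold ⟩
    d u v + (T + T)           ≤⟨ +-monoʳ-≤ (d u v) (+-mono-≤ T≤p T≤p) ⟩
    d u v + (p + p)           ≤⟨ +-monoˡ-≤ (p + p) (d-triangle-through s u v) ⟩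
    d s u + d s v + (p + p)   ≡⟨ interchange (d s u) (d s v) p p ⟩
    (d s u + p) + (d s v + p) ≤⟨ +-mono-≤ su+p≤ sv+p≤ ⟩
    suc (d x u) + suc (d x v) ≡⟨ cong suc (+-suc (d x u) (d x v)) ⟩
    2 + (d x u + d x v)       ∎)
    where open ≤-Reasoning

  -- Levels below T are charged to the path towards u only.
  two-geodesics-covering : ∀ u v T → 3 + (d x u + d x v) ≤ d u v + (T + T) →
                           suc (d x u) + (suc (d x v) ∸ T) ≤ 3 * ∣ S ∣
  two-geodesics-covering u v T threshold =
    two-branch-covering 0 (d x u) T (d x v) (λ (_ , p≤xu) → geodesic-covered u p≤xu)
      λ (T≤p , p≤xv) → let s , s∈S , covers = geodesic-covered v p≤xv in s , s∈S , T≤p , covers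
    where
    open TwoBranchCovering S (d x) (covers? u) (λ s p → T ≤? p ×-dec covers? v s p)
                           proj₁ (proj₁ ∘ proj₂) (covers-exclusive threshold)

  perimeter-bound : ∀ u v → d x u + d x v + d u v ≤ 6 * ∣ S ∣
  perimeter-bound u v =
    let T , threshold , T-upper = halve-difference (≤-trans (d-triangle-through x u v) (m≤n+m _ 3))
    in subst (d x u + d x v + d u v ≤_) (sym (*-assoc 2 3 ∣ S ∣))
             (perimeter-arithmetic (d x u) (d x v) (d u v) T (suc (d x v) ∸ T) (3 * ∣ S ∣)
                                   T-upper (m≤n+m∸n (suc (d x v)) T)
                                   (two-geodesics-covering u v T threshold))

theorem4 : ∀ (n : ℕ) (G : Graph n) → 2 ≤ n → Connected G →
           ∀ (g e : ℕ) → DomNumber G g → EccSet G (Boundary G) e →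
           e + 1 ≤ 2 * g
theorem4 _ G (s≤s (s≤s _)) connected _ e ((S , dominating , refl) , _)
         (_ , x , (_ , (_ , diam@((u , v , uv) , _) , _) , _) , below) =
  3e+1≤6g⇒e+1≤2g e ∣ S ∣ (begin
    3 * e + 1             ≡⟨ solve (e ∷ []) ⟩
    e + e + suc e         ≤⟨ +-mono-≤ (+-mono-≤ (below u u∈B _ (d-walk x u)) (below v v∈B _ (d-walk x v)))
                                      e<uv ⟩
    d x u + d x v + d u v ≤⟨ perimeter-bound u v ⟩
    6 * ∣ S ∣             ∎)
  where
  open ≤-Reasoning
  open Walks G
  open Distance G connected
  open Perimeter G connected dominating x
  u∈B : Boundary G u
  u∈B = diametral-in-boundary diam uv
  v∈B : Boundary G v
  v∈B = diametral-in-boundary diam (Dist-sym uv)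
  e<uv : e < d u v
  e<uv = subst (e <_) (Dist⇒≡d uv) (boundary-lower-bound<Diam {zero} {suc zero} (λ ()) diam below)
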